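{- Let $n$ be a nonnegative integer and let $C_n=\frac{1}{n+1}\binom{2n}{n}$ be the $n$-th Catalan number. Then \[ C_{n}=\frac{1}{n+1}\binom{3n}{n}-\frac{1}{n+1}\sum_{j=0}^{n-1}\binom{n+j}{j}\binom{2n-j-1}{n-j}. \]
   Context: An empty sum equals $0$. -}

module Defs where

open import Data.Nat using (ℕ; zero; suc; _+_; _*_; _∸_)
open import Data.Nat.Combinatorics using (_C_)
open import Data.Rational using (ℚ; _/_) renaming (_*_ to _*ℚ_)
open import Data.Integer using (+_)

sumTo : ℕ → (ℕ → ℕ) → ℕ
sumTo zero    f = 0
sumTo (suc n) f = sumTo n f + f n

catalan : ℕ → ℚ
catalan n = (+ 1 / suc n) *ℚ (+ ((2 * n) C n) / 1)

module Submission where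

-- Write  t n j = C(n+j, j) · C(2n-j-1, n-j)  for the summands.
-- Clearing the common factor 1/(n+1), the theorem is the identity of
-- natural numbers
--      Σ_{j<n} t n j + C(2n, n) = C(3n, n),
-- and since the "missing" summand  t n n  equals  C(2n, n),  this says
-- Σ_{j≤n} t n j = C(3n, n).  For n = p+1 the summand is
-- C(n+j, j) · C(p + (n-j), n-j),  so the sum is the convolution of the
-- diagonals  k ↦ C(a+k, k)  for  a = n  and  a = p,  and the
-- Chu–Vandermonde identity  Σ_{k≤m} C(a+k, k) C(c+m-k, m-k) = C(a+c+1+m, m)
-- evaluates it to  C(3n, n).

open import Defs
open import Data.Nat using (ℕ; zero; suc; _+_; _*_; _∸_; _≤_; _<_)
open import Data.Nat.Combinatorics using (_C_)
open import Data.Rational using (ℚ; _-_; _/_) renaming (_*_ to _*ℚ_)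
open import Data.Integer using (+_)
open import Relation.Binary.PropositionalEquality using (_≡_)

open import Relation.Binary.PropositionalEquality
  using (refl; sym; trans; cong; cong₂; module ≡-Reasoning)
import Data.Nat.Properties as ℕP
import Data.Nat.Combinatorics as Comb
open import Data.Nat.Tactic.RingSolver using (solve-∀)
open import Data.Nat.Coprimality using (Coprime; 1-coprimeTo) renaming (sym to coprime-sym)
import Data.Rational as ℚ
import Data.Rational.Properties as ℚP
import Data.Integer as ℤ
import Data.Integer.Properties as ℤP
open import Algebra.Properties.CommutativeSemigroup ℕP.+-commutativeSemigroup
  using (interchange)
open import Algebra.Properties.AbelianGroup ℚP.+-0-abelianGroup
  using (xyx⁻¹≈y)

-- pascal a k = C(a+k, k), computed by Pascal's rule on the (a, k) grid;
-- this recursion is what makes the Vandermonde induction go through.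
pascal : ℕ → ℕ → ℕ
pascal zero    k       = 1
pascal (suc a) zero    = 1
pascal (suc a) (suc k) = pascal a (suc k) + pascal (suc a) k

pascal-zero : ∀ a → pascal a 0 ≡ 1
pascal-zero zero    = refl
pascal-zero (suc a) = refl

pascal≡C : ∀ a k → pascal a k ≡ (a + k) C k
pascal≡C zero    k       = sym (Comb.nCn≡1 k)
pascal≡C (suc a) zero    = refl
pascal≡C (suc a) (suc k) = begin
    pascal a (suc k) + pascal (suc a) k
  ≡⟨ cong₂ _+_ (pascal≡C a (suc k)) (pascal≡C (suc a) k) ⟩
    (a + suc k) C suc k + suc (a + k) C k
  ≡⟨ cong (λ x → x C suc k + suc (a + k) C k) (ℕP.+-suc a k) ⟩
    suc (a + k) C suc k + suc (a + k) C k
  ≡⟨ ℕP.+-comm (suc (a + k) C suc k) _ ⟩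
    suc (a + k) C k + suc (a + k) C suc k
  ≡⟨ Comb.nCk+nC[k+1]≡[n+1]C[k+1] (suc a + k) k ⟩
    suc (suc (a + k)) C suc k
  ≡⟨ cong (_C suc k) (sym (ℕP.+-suc (suc a) k)) ⟩
    (suc a + suc k) C suc k ∎
  where open ≡-Reasoning

-- convolution f g m = Σ_{k≤m} f k · g (m-k), unfolded from the front so
-- that induction on m shifts the first sequence.
convolution : (ℕ → ℕ) → (ℕ → ℕ) → ℕ → ℕ
convolution f g zero    = f 0 * g 0
convolution f g (suc m) = f 0 * g (suc m) + convolution (λ k → f (suc k)) g m

convolution-+ : ∀ f h g m →
  convolution (λ k → f k + h k) g m ≡ convolution f g m + convolution h g m
convolution-+ f h g zero    = ℕP.*-distribʳ-+ (g 0) (f 0) (h 0)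
convolution-+ f h g (suc m) = begin
    (f 0 + h 0) * g (suc m) + convolution (λ k → f (suc k) + h (suc k)) g m
  ≡⟨ cong₂ _+_ (ℕP.*-distribʳ-+ (g (suc m)) (f 0) (h 0))
               (convolution-+ (λ k → f (suc k)) (λ k → h (suc k)) g m) ⟩
    (f 0 * g (suc m) + h 0 * g (suc m))
      + (convolution (λ k → f (suc k)) g m + convolution (λ k → h (suc k)) g m)
  ≡⟨ interchange (f 0 * g (suc m)) _ _ _ ⟩
    convolution f g (suc m) + convolution h g (suc m) ∎
  where open ≡-Reasoning

hockeyStick : ∀ c m → convolution (λ _ → 1) (pascal c) m ≡ pascal (suc c) m
hockeyStick c zero    = trans (ℕP.+-identityʳ (pascal c 0)) (pascal-zero c)
hockeyStick c (suc m) =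
  cong₂ _+_ (ℕP.+-identityʳ (pascal c (suc m))) (hockeyStick c m)

-- Induction on a: Pascal's rule splits the first factor, and the two
-- resulting convolutions are the instances (a, m+1) and (a+1, m).
vandermonde : ∀ a c m →
  convolution (pascal a) (pascal c) m ≡ pascal (suc (a + c)) m
vandermonde zero    c m       = hockeyStick c m
vandermonde (suc a) c zero    = trans (ℕP.+-identityʳ (pascal c 0)) (pascal-zero c)
vandermonde (suc a) c (suc m) = begin
    1 * pascal c (suc m)
      + convolution (λ k → pascal a (suc k) + pascal (suc a) k) (pascal c) m
  ≡⟨ cong (_+_ (1 * pascal c (suc m)))
          (convolution-+ (λ k → pascal a (suc k)) (pascal (suc a)) (pascal c) m) ⟩
    1 * pascal c (suc m)
      + (convolution (λ k → pascal a (suc k)) (pascal c) m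
         + convolution (pascal (suc a)) (pascal c) m)
  ≡⟨ sym (ℕP.+-assoc (1 * pascal c (suc m)) _ _) ⟩
    (1 * pascal c (suc m) + convolution (λ k → pascal a (suc k)) (pascal c) m)
      + convolution (pascal (suc a)) (pascal c) m
  ≡⟨ cong (λ x → (x * pascal c (suc m)
                    + convolution (λ k → pascal a (suc k)) (pascal c) m)
                 + convolution (pascal (suc a)) (pascal c) m)
          (sym (pascal-zero a)) ⟩
    convolution (pascal a) (pascal c) (suc m)
      + convolution (pascal (suc a)) (pascal c) m
  ≡⟨ cong₂ _+_ (vandermonde a c (suc m)) (vandermonde (suc a) c m) ⟩
    pascal (suc (a + c)) (suc m) + pascal (suc (suc (a + c))) m ∎
  where open ≡-Reasoning

sumTo-front : ∀ m h → sumTo (suc m) h ≡ h 0 + sumTo m (λ k → h (suc k))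
sumTo-front zero    h = ℕP.+-comm 0 (h 0)
sumTo-front (suc m) h = trans (cong (_+ h (suc m)) (sumTo-front m h))
  (ℕP.+-assoc (h 0) (sumTo m (λ k → h (suc k))) (h (suc m)))

sumTo≡convolution : ∀ m f g →
  sumTo (suc m) (λ k → f k * g (m ∸ k)) ≡ convolution f g m
sumTo≡convolution zero    f g = refl
sumTo≡convolution (suc m) f g = trans (sumTo-front (suc m) _)
  (cong (_+_ (f 0 * g (suc m))) (sumTo≡convolution m (λ k → f (suc k)) g))

sumTo-cong : ∀ n f h → (∀ k → k < n → f k ≡ h k) → sumTo n f ≡ sumTo n h
sumTo-cong zero    f h eq = refl
sumTo-cong (suc n) f h eq =
  cong₂ _+_ (sumTo-cong n f h (λ k k<n → eq k (ℕP.m<n⇒m<1+n k<n)))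
            (eq n (ℕP.n<1+n n))

term : ℕ → ℕ → ℕ
term n j = ((n + j) C j) * (((2 * n) ∸ j ∸ 1) C (n ∸ j))

-- For n = p+1 and j ≤ n the upper index  2n-j-1  equals  p + (n-j),
-- so the second factor is a diagonal binomial.
upperIndex : ∀ p j → j ≤ suc p → (2 * suc p) ∸ j ∸ 1 ≡ p + (suc p ∸ j)
upperIndex p j j≤n = begin
    (2 * suc p) ∸ j ∸ 1
  ≡⟨ ℕP.∸-+-assoc (2 * suc p) j 1 ⟩
    (2 * suc p) ∸ (j + 1)
  ≡⟨ cong ((2 * suc p) ∸_) (ℕP.+-comm j 1) ⟩
    (2 * suc p) ∸ (1 + j)
  ≡⟨ sym (ℕP.∸-+-assoc (2 * suc p) 1 j) ⟩
    (p + (suc p + 0)) ∸ j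
  ≡⟨ cong (λ x → (p + x) ∸ j) (ℕP.+-identityʳ (suc p)) ⟩
    (p + suc p) ∸ j
  ≡⟨ ℕP.+-∸-assoc p j≤n ⟩
    p + (suc p ∸ j) ∎
  where open ≡-Reasoning

term-pascal : ∀ p j → j ≤ suc p →
  term (suc p) j ≡ pascal (suc p) j * pascal p (suc p ∸ j)
term-pascal p j j≤n = sym (cong₂ _*_ (pascal≡C (suc p) j)
  (trans (pascal≡C p (suc p ∸ j)) (cong (_C (suc p ∸ j)) (sym (upperIndex p j j≤n)))))

-- The upper index produced by Vandermonde:  (n+p+1) + n = 3n  for n = p+1.
upperIndex-3n : ∀ p → suc (suc p + p) + suc p ≡ 3 * suc p
upperIndex-3n = solve-∀

fullSum : ∀ n → sumTo (suc n) (term n) ≡ (3 * n) C n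
fullSum zero    = refl
fullSum (suc p) = begin
    sumTo (suc (suc p)) (term (suc p))
  ≡⟨ sumTo-cong (suc (suc p)) _ _ (λ j j<n+1 → term-pascal p j (ℕP.≤-pred j<n+1)) ⟩
    sumTo (suc (suc p)) (λ j → pascal (suc p) j * pascal p (suc p ∸ j))
  ≡⟨ sumTo≡convolution (suc p) (pascal (suc p)) (pascal p) ⟩
    convolution (pascal (suc p)) (pascal p) (suc p)
  ≡⟨ vandermonde (suc p) p (suc p) ⟩
    pascal (suc (suc p + p)) (suc p)
  ≡⟨ pascal≡C (suc (suc p + p)) (suc p) ⟩
    (suc (suc p + p) + suc p) C suc p
  ≡⟨ cong (_C suc p) (upperIndex-3n p) ⟩
    (3 * suc p) C suc p ∎
  where open ≡-Reasoning

term-last : ∀ n → term n n ≡ (2 * n) C n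
term-last n = begin
    ((n + n) C n) * (((2 * n) ∸ n ∸ 1) C (n ∸ n))
  ≡⟨ cong (λ x → ((n + n) C n) * ((2 * n ∸ n ∸ 1) C x)) (ℕP.n∸n≡0 n) ⟩
    ((n + n) C n) * 1
  ≡⟨ ℕP.*-identityʳ _ ⟩
    (n + n) C n
  ≡⟨ cong (λ x → (n + x) C n) (sym (ℕP.+-identityʳ n)) ⟩
    (2 * n) C n ∎
  where open ≡-Reasoning

catalanSum : ∀ n → sumTo n (term n) + (2 * n) C n ≡ (3 * n) C n
catalanSum n = trans (cong (_+_ (sumTo n (term n))) (sym (term-last n))) (fullSum n)

-- Passage to ℚ.  A natural number  m  is the rational  m / 1,  which is
-- the already-reduced fraction with numerator m and denominator 1.
coprimeTo1 : ∀ m → Coprime m 1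
coprimeTo1 m = coprime-sym (1-coprimeTo m)

fromℕ-+ : ∀ m n → + (m + n) / 1 ≡ (+ m / 1) ℚ.+ (+ n / 1)
fromℕ-+ m n = begin
    + (m + n) / 1
  ≡⟨ ℚP./-cong {+ (m + n)} {1} {+ m ℤ.* + 1 ℤ.+ + n ℤ.* + 1} {1}
       (sym (cong₂ ℤ._+_ (ℤP.*-identityʳ (+ m)) (ℤP.*-identityʳ (+ n)))) refl ⟩
    (+ m ℤ.* + 1 ℤ.+ + n ℤ.* + 1) / 1
  ≡⟨⟩
    ℚ.mkℚ (+ m) 0 (coprimeTo1 m) ℚ.+ ℚ.mkℚ (+ n) 0 (coprimeTo1 n)
  ≡⟨ sym (cong₂ ℚ._+_ (ℚP.normalize-coprime (coprimeTo1 m))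
                      (ℚP.normalize-coprime (coprimeTo1 n))) ⟩
    (+ m / 1) ℚ.+ (+ n / 1) ∎
  where open ≡-Reasoning

scaledDifference : ∀ k s x y → s + x ≡ y →
  k *ℚ (+ x / 1) ≡ k *ℚ (+ y / 1) - k *ℚ (+ s / 1)
scaledDifference k s x y refl = sym (begin
    k *ℚ (+ (s + x) / 1) - k *ℚ (+ s / 1)
  ≡⟨ cong (λ q → k *ℚ q - k *ℚ (+ s / 1)) (fromℕ-+ s x) ⟩
    k *ℚ ((+ s / 1) ℚ.+ (+ x / 1)) - k *ℚ (+ s / 1)
  ≡⟨ cong (_- k *ℚ (+ s / 1)) (ℚP.*-distribˡ-+ k (+ s / 1) (+ x / 1)) ⟩
    (k *ℚ (+ s / 1) ℚ.+ k *ℚ (+ x / 1)) - k *ℚ (+ s / 1)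
  ≡⟨ xyx⁻¹≈y (k *ℚ (+ s / 1)) (k *ℚ (+ x / 1)) ⟩
    k *ℚ (+ x / 1) ∎)
  where open ≡-Reasoning

mainTheorem16 : (n : ℕ) →
    catalan n ≡
      ((+ 1 / suc n) *ℚ (+ ((3 * n) C n) / 1))
      - ((+ 1 / suc n) *ℚ (+ (sumTo n (λ j → ((n + j) C j) * (((2 * n) ∸ j ∸ 1) C (n ∸ j)))) / 1))
mainTheorem16 n =
  scaledDifference (+ 1 / suc n) (sumTo n (term n)) ((2 * n) C n) ((3 * n) C n)
    (catalanSum n)
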